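{- Let $n,m\in\mathbb N$ with $\gcd(n,m)=1$ and let $\{R_j^{nm,n}\}_{j\in I_{nm,n}}$ be a system of representatives with $\Gamma_0(n)=\bigsqcup_{j\in I_{nm,n}}\Gamma_0(nm)R_j^{nm,n}$. Then for every $j\in I_{nm,n}$ there exists a matrix $A(j)\in X_m^\star$ such that $B_mR_j^{nm,n}A(j)^{ -1}\in\Gamma_0(n)$, and the map $j\mapsto A(j)$ is bijective (onto $X_m^\star$).
   Context: $\Gamma_0(N)=\{\begin{pmatrix}a&b\\c&d\end{pmatrix}\in SL(2,\mathbb Z):N\mid c\}$, $B_m=\begin{pmatrix}m&0\\0&1\end{pmatrix}$, $I_{nm,n}=\{1,\dots,[\Gamma_0(n):\Gamma_0(nm)]\}$, $X_m^\star=\{\begin{pmatrix}c&b\\0&m/c\end{pmatrix}:c\ge1,\ c\mid m,\ 0\le b\le m/c-1,\ \gcd(c,b,m/c)=1\}$. -}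

module Defs where

open import Data.Nat as ℕ using (ℕ; _<_; _≤_)
open import Data.Nat.GCD using (gcd)
open import Data.Integer as ℤ using (ℤ; +_; _*_; _-_; _+_)
open import Data.Integer.Divisibility using (_∣_)
open import Data.Fin using (Fin)
open import Data.Product using (Σ; ∃; ∃-syntax; _×_)
open import Relation.Binary.PropositionalEquality using (_≡_)

record Mat : Set where
  constructor mat
  field
    a b c d : ℤ
open Mat public

infixl 7 _⊗_
_⊗_ : Mat → Mat → Mat
mat a₁ b₁ c₁ d₁ ⊗ mat a₂ b₂ c₂ d₂ =
  mat (a₁ * a₂ + b₁ * c₂) (a₁ * b₂ + b₁ * d₂)
      (c₁ * a₂ + d₁ * c₂) (c₁ * b₂ + d₁ * d₂)

det : Mat → ℤ
det (mat a b c d) = a * d - b * c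

InSL2 : Mat → Set
InSL2 M = det M ≡ + 1

InΓ₀ : ℕ → Mat → Set
InΓ₀ N M = InSL2 M × (+ N ∣ c M)

B : ℕ → Mat
B m = mat (+ m) (+ 0) (+ 0) (+ 1)

InCoset : ℕ → Mat → Mat → Set
InCoset N R g = ∃[ γ ] (InΓ₀ N γ × g ≡ γ ⊗ R)

IsCosetReps : ℕ → ℕ → (k : ℕ) → (Fin k → Mat) → Set
IsCosetReps N n k R =
    (∀ j → InΓ₀ n (R j))
  × (∀ g → InΓ₀ n g → ∃[ j ] InCoset N (R j) g)
  × (∀ g i j → InCoset N (R i) g → InCoset N (R j) g → i ≡ j)

-- membership in X_m^⋆ = { (c b ; 0 m/c) : c ≥ 1, c ∣ m, 0 ≤ b ≤ m/c - 1,
--                          gcd(c, b, m/c) = 1 }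
-- (here d plays the role of m/c, i.e. c * d = m)
InXstar : ℕ → Mat → Set
InXstar m M =
  ∃[ c' ] ∃[ b' ] ∃[ d' ]
    ( (1 ≤ c') × (c' ℕ.* d' ≡ m) × (b' < d')
    × (gcd (gcd c' b') d' ≡ 1)
    × (M ≡ mat (+ c') (+ b') (+ 0) (+ d')) )

module Submission where

-- For R ∈ SL(2,ℤ), row reduction over SL(2,ℤ) writes B_m R = γ A with A ∈ X_m^⋆: the first
-- diagonal entry of A is g = gcd(c, m) and its b-entry solves a linear congruence modulo m/g.
-- A is unique in its SL(2,ℤ)-orbit. Comparing lower-left entries gives c(R) = g · c(γ) with
-- g ∣ m, so γ ∈ Γ₀(n) when R ∈ Γ₀(n) and gcd(n, m) = 1.
-- If R_i and R_j give the same A, then ε = R_i R_j⁻¹ satisfies B_m ε = τ B_m with τ ∈ Γ₀(n),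
-- so c(ε) = m c(τ) and ε ∈ Γ₀(nm): the map j ↦ A(j) is injective. Conversely, for
-- A = (c b; 0 d) ∈ X_m^⋆ choose t with gcd(nc, nb + td) = 1 and complete the row
-- (nc, nb + td) = (n, t) A to some g ∈ Γ₀(n); then B_m g = γ A with γ ∈ Γ₀(n), and by
-- uniqueness the representative of the Γ₀(nm)-coset of g is sent to A.

open import Defs
open import Data.Nat as ℕ
  using (ℕ; suc; _<_; _≤_; NonZero; NonTrivial; >-nonZero; ≢-nonZero; ≢-nonZero⁻¹)
import Data.Nat.Properties as ℕ
open import Data.Nat.Divisibility
  using ( _∣_; divides; quotient; quotient-<; quotient≢0; ∣-refl; ∣-trans; ∣1⇒≡1
        ; ∣m+n∣m⇒∣n; ∣m⇒∣m*n; m*n∣⇒n∣; *-monoˡ-∣)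
open import Data.Nat.GCD
  using (gcd; module Bézout; GCD; gcd-GCD; GCD-*; gcd-greatest; gcd[m,n]∣m; gcd[m,n]∣n; gcd[m,n]≢0)
open import Data.Nat.Coprimality
  using (Coprime; gcd≡1⇒coprime; GCD≡1⇒coprime; coprime-divisor; coprime-Bézout)
open import Data.Nat.Induction using (<-wellFounded)
open import Induction.WellFounded using (Acc; acc)
open import Data.Integer as ℤ
  using (ℤ; +_; +[1+_]; -[1+_]; -_; _*_; _-_; _+_; 0ℤ; 1ℤ; -1ℤ; ∣_∣)
import Data.Integer.Properties as ℤ
import Data.Integer.Coprimality as ℤ
open import Data.Integer.Divisibility as ℤ using ()
import Data.Integer.Divisibility.Signed as Signed
open import Data.Integer.DivMod using (_%ℕ_; _/ℕ_; n%ℕd<d; a≡a%ℕn+[a/ℕn]*n)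
open import Data.Integer.Tactic.RingSolver using (solve-∀)
open import Data.Fin using (Fin)
open import Data.Empty using (⊥-elim)
open import Data.Sum using (inj₁; inj₂)
open import Data.Product using (∃; ∃₂; ∃-syntax; _×_; _,_; proj₁; proj₂)
open import Relation.Nullary using (yes; no; contradiction)
open import Relation.Binary.PropositionalEquality
  using (_≡_; _≢_; refl; sym; trans; cong; cong₂; subst; subst₂; module ≡-Reasoning)

-- Arithmetic

≢1⇒nonTrivial : ∀ {g} .{{_ : NonZero g}} → g ≢ 1 → NonTrivial g
≢1⇒nonTrivial {1} g≢1 = contradiction refl g≢1
≢1⇒nonTrivial {suc (suc _)} _ = _

coprime-part : ∀ {a} b .{{_ : NonZero a}} → Acc _<_ a →
               ∃ λ t → Coprime t b × (∀ {e} → e ∣ a → Coprime e b → e ∣ t)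
coprime-part {a} b (acc smaller) with gcd a b ℕ.≟ 1
... | yes gcd≡1 = a , gcd≡1⇒coprime gcd≡1 , λ e∣a _ → e∣a
... | no gcd≢1 =
  let (t , t⊥b , maximal) = coprime-part b (smaller (quotient-< g∣a))
  in  t , t⊥b , λ e∣a e⊥b → maximal (coprime-divisor (e⊥g e⊥b) (e∣ga′ e∣a)) e⊥b
  where
  g = gcd a b
  instance
    _ : NonZero g
    _ = ≢-nonZero (gcd[m,n]≢0 a b (inj₁ (≢-nonZero⁻¹ a)))
    _ : NonTrivial g
    _ = ≢1⇒nonTrivial gcd≢1
  g∣a = gcd[m,n]∣m a b
  a′ = quotient g∣a
  instance
    _ : NonZero a′
    _ = quotient≢0 g∣a
  e⊥g : ∀ {e} → Coprime e b → Coprime e g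
  e⊥g e⊥b (i∣e , i∣g) = e⊥b (i∣e , ∣-trans i∣g (gcd[m,n]∣n a b))
  e∣ga′ : ∀ {e} → e ∣ a → e ∣ g ℕ.* a′
  e∣ga′ = subst (_ ∣_) (trans (_∣_.equality g∣a) (ℕ.*-comm a′ g))

-- With t the part of a coprime to b, a common divisor e of a and b + t c is coprime to b
-- (gcd(e, b) divides t c and is prime to t, so it divides c), hence e ∣ t, e ∣ b and e = 1.
coprime-shift : ∀ {a b c} .{{_ : NonZero a}} → (∀ {e} → e ∣ a → e ∣ b → e ∣ c → e ≡ 1) →
                ∃ λ t → Coprime a (b ℕ.+ t ℕ.* c)
coprime-shift {a} {b} {c} common≡1 = t , a⊥b+tc
  where
  part = coprime-part b (<-wellFounded a)
  t = proj₁ part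
  t⊥b = proj₁ (proj₂ part)
  maximal = proj₂ (proj₂ part)
  a⊥b+tc : Coprime a (b ℕ.+ t ℕ.* c)
  a⊥b+tc {e} (e∣a , e∣b+tc) = e⊥b (∣-refl , e∣b)
    where
    h = gcd e b
    h∣b = gcd[m,n]∣n e b
    h∣c : h ∣ c
    h∣c = coprime-divisor (λ (i∣h , i∣t) → t⊥b (i∣t , ∣-trans i∣h h∣b))
                          (∣m+n∣m⇒∣n (∣-trans (gcd[m,n]∣m e b) e∣b+tc) h∣b)
    e⊥b : Coprime e b
    e⊥b = gcd≡1⇒coprime (common≡1 (∣-trans (gcd[m,n]∣m e b) e∣a) h∣b h∣c)
    e∣b : e ∣ b
    e∣b = ∣m+n∣m⇒∣n (subst (e ∣_) (ℕ.+-comm b (t ℕ.* c)) e∣b+tc) (∣m⇒∣m*n c (maximal e∣a e⊥b))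

coprime-quotients : ∀ {x y x₀ y₀} .{{_ : NonZero (gcd x y)}} →
                    x ≡ x₀ ℕ.* gcd x y → y ≡ y₀ ℕ.* gcd x y → Coprime x₀ y₀
coprime-quotients {x} {y} {x₀} {y₀} x≡x₀g y≡y₀g = GCD≡1⇒coprime (GCD-* {x₀} {y₀} {1} {gcd x y}
  (subst₂ (λ x′ y′ → GCD x′ y′ (1 ℕ.* gcd x y)) x≡x₀g y≡y₀g
    (subst (GCD x y) (sym (ℕ.*-identityˡ (gcd x y))) (gcd-GCD x y))))

sign-unit : ∀ x → ∃ λ s → s * x ≡ + ∣ x ∣
sign-unit (+ n)    = 1ℤ , ℤ.*-identityˡ (+ n)
sign-unit -[1+ n ] = -1ℤ , ℤ.-1*i≡-i -[1+ n ]

pos-1+*≡* : ∀ x y m n → 1 ℕ.+ y ℕ.* n ≡ x ℕ.* m → 1ℤ + + y * + n ≡ + x * + m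
pos-1+*≡* x y m n eq = begin
  1ℤ + + y * + n     ≡⟨ cong (_+_ 1ℤ) (ℤ.pos-* y n) ⟨
  1ℤ + + (y ℕ.* n)   ≡⟨ ℤ.pos-+ 1 (y ℕ.* n) ⟨
  + (1 ℕ.+ y ℕ.* n)  ≡⟨ cong +_ eq ⟩
  + (x ℕ.* m)        ≡⟨ ℤ.pos-* x m ⟩
  + x * + m          ∎
  where open ≡-Reasoning

ℕ-bézout : ∀ {m n} → Bézout.Identity 1 m n → ∃₂ λ u v → u * + m + v * + n ≡ 1ℤ
ℕ-bézout {m} {n} (Bézout.+- x y eq) = + x , - + y , (begin
  + x * + m + - + y * + n          ≡⟨ cong (_+ - + y * + n) (pos-1+*≡* x y m n eq) ⟨
  1ℤ + + y * + n + - + y * + n     ≡⟨ cancel (+ y) (+ n) ⟩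
  1ℤ                               ∎)
  where
  open ≡-Reasoning
  cancel : ∀ y n → 1ℤ + y * n + - y * n ≡ 1ℤ
  cancel = solve-∀
ℕ-bézout {m} {n} (Bézout.-+ x y eq) = - + x , + y , (begin
  - + x * + m + + y * + n              ≡⟨ cong (λ z → - + x * + m + z) (pos-1+*≡* y x n m eq) ⟨
  - + x * + m + (1ℤ + + x * + m)       ≡⟨ cancel (+ x) (+ m) ⟩
  1ℤ                                   ∎)
  where
  open ≡-Reasoning
  cancel : ∀ x m → - x * m + (1ℤ + x * m) ≡ 1ℤ
  cancel = solve-∀

bézout : ∀ {x y} → ℤ.Coprime x y → ∃₂ λ u v → u * x + v * y ≡ 1ℤ
bézout {x} {y} x⊥y =
  let (s , sx≡∣x∣) = sign-unit x
      (t , ty≡∣y∣) = sign-unit y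
      (u , v , bézout-ℕ) = ℕ-bézout {∣ x ∣} {∣ y ∣} (coprime-Bézout x⊥y)
  in  u * s , v * t , (begin
        u * s * x + v * t * y      ≡⟨ cong₂ _+_ (ℤ.*-assoc u s x) (ℤ.*-assoc v t y) ⟩
        u * (s * x) + v * (t * y)  ≡⟨ cong₂ (λ p q → u * p + v * q) sx≡∣x∣ ty≡∣y∣ ⟩
        u * + ∣ x ∣ + v * + ∣ y ∣  ≡⟨ bézout-ℕ ⟩
        1ℤ                         ∎)
  where open ≡-Reasoning

linear-congruence : ∀ {x y} .{{_ : NonZero y}} → ℤ.Coprime x (+ y) → ∀ z →
                    ∃₂ λ r t → r < y × x * + r + t * + y ≡ z
linear-congruence {x} {y} x⊥y z = r , z * v + x * k , n%ℕd<d (z * u) y , (begin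
  x * + r + (z * v + x * k) * + y      ≡⟨ regroup₁ x (+ r) z v k (+ y) ⟩
  x * (+ r + k * + y) + z * (v * + y)  ≡⟨ cong (λ w → x * w + z * (v * + y)) (a≡a%ℕn+[a/ℕn]*n (z * u) y) ⟨
  x * (z * u) + z * (v * + y)          ≡⟨ regroup₂ x z u v (+ y) ⟩
  z * (u * x + v * + y)                ≡⟨ cong (z *_) ux+vy≡1 ⟩
  z * 1ℤ                               ≡⟨ ℤ.*-identityʳ z ⟩
  z                                    ∎)
  where
  open ≡-Reasoning
  coefficients = bézout {x} {+ y} x⊥y
  u = proj₁ coefficients
  v = proj₁ (proj₂ coefficients)
  ux+vy≡1 = proj₂ (proj₂ coefficients)
  r = (z * u) %ℕ y
  k = (z * u) /ℕ y
  regroup₁ : ∀ x r z v k y → x * r + (z * v + x * k) * y ≡ x * (r + k * y) + z * (v * y)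
  regroup₁ = solve-∀
  regroup₂ : ∀ x z u v y → x * (z * u) + z * (v * y) ≡ z * (u * x + v * y)
  regroup₂ = solve-∀

pos-+*-injective : ∀ x y z {w} → + x + + y * + z ≡ + w → x ℕ.+ y ℕ.* z ≡ w
pos-+*-injective x y z eq = ℤ.+-injective (trans (trans (ℤ.pos-+ x (y ℕ.* z)) (cong (_+_ (+ x)) (ℤ.pos-* y z))) eq)

d≤x+[1+k]d : ∀ x k d → d ≤ x ℕ.+ suc k ℕ.* d
d≤x+[1+k]d x k d = ℕ.≤-trans (ℕ.m≤m+n d (k ℕ.* d)) (ℕ.m≤n+m (suc k ℕ.* d) x)

nonneg-unit≡1 : ∀ {p s k c} → p * s ≡ 1ℤ → p * + suc k ≡ + c → p ≡ 1ℤ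
nonneg-unit≡1 {+ p} {s} ps≡1 _ =
  cong +_ (ℕ.m*n≡1⇒m≡1 p ∣ s ∣ (trans (sym (ℤ.abs-* (+ p) s)) (cong ∣_∣ ps≡1)))
nonneg-unit≡1 { -[1+ _ ]} _ ()

residue-unique : ∀ {b₁ b₂ d} q → + b₁ + q * + d ≡ + b₂ → b₁ < d → b₂ < d → b₁ ≡ b₂
residue-unique {b₁} (+ 0) eq _ _ = ℤ.+-injective (trans (sym (ℤ.+-identityʳ (+ b₁))) eq)
residue-unique {b₁} {b₂} {d} +[1+ k ] eq _ b₂<d =
  ⊥-elim (ℕ.<⇒≱ b₂<d (subst (d ≤_) (pos-+*-injective b₁ (suc k) d eq) (d≤x+[1+k]d b₁ k d)))
residue-unique {b₁} {b₂} {d} -[1+ k ] eq b₁<d _ =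
  ⊥-elim (ℕ.<⇒≱ b₁<d (subst (d ≤_) (pos-+*-injective b₂ (suc k) d (begin
    + b₂ + +[1+ k ] * + d                        ≡⟨ cong (_+ +[1+ k ] * + d) eq ⟨
    + b₁ + -[1+ k ] * + d + +[1+ k ] * + d       ≡⟨ cong (λ x → + b₁ + x + +[1+ k ] * + d)
                                                            (ℤ.neg-distribˡ-* +[1+ k ] (+ d)) ⟨
    + b₁ + - (+[1+ k ] * + d) + +[1+ k ] * + d   ≡⟨ cancel (+ b₁) (+[1+ k ] * + d) ⟩
    + b₁                                         ∎)) (d≤x+[1+k]d b₂ k d)))
  where
  open ≡-Reasoning
  cancel : ∀ x y → x + - y + y ≡ x
  cancel = solve-∀

-- 2×2 integer matrices

mat-cong : ∀ {a b c d a′ b′ c′ d′} →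
           a ≡ a′ → b ≡ b′ → c ≡ c′ → d ≡ d′ → mat a b c d ≡ mat a′ b′ c′ d′
mat-cong refl refl refl refl = refl

I₂ : Mat
I₂ = mat 1ℤ 0ℤ 0ℤ 1ℤ

adj : Mat → Mat
adj (mat a b c d) = mat d (- b) (- c) a

⊗-assoc : ∀ M N P → (M ⊗ N) ⊗ P ≡ M ⊗ (N ⊗ P)
⊗-assoc (mat a₁ b₁ c₁ d₁) (mat a₂ b₂ c₂ d₂) (mat a₃ b₃ c₃ d₃) =
  mat-cong (entry a₁ b₁ a₂ b₂ c₂ d₂ a₃ c₃) (entry a₁ b₁ a₂ b₂ c₂ d₂ b₃ d₃)
           (entry c₁ d₁ a₂ b₂ c₂ d₂ a₃ c₃) (entry c₁ d₁ a₂ b₂ c₂ d₂ b₃ d₃)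
  where
  entry : ∀ x y a b c d z w →
          (x * a + y * c) * z + (x * b + y * d) * w ≡ x * (a * z + b * w) + y * (c * z + d * w)
  entry = solve-∀

⊗-identityˡ : ∀ M → I₂ ⊗ M ≡ M
⊗-identityˡ (mat a b c d) = mat-cong (top a c) (top b d) (bottom a c) (bottom b d)
  where
  top : ∀ x y → 1ℤ * x + 0ℤ * y ≡ x
  top = solve-∀
  bottom : ∀ x y → 0ℤ * x + 1ℤ * y ≡ y
  bottom = solve-∀

⊗-identityʳ : ∀ M → M ⊗ I₂ ≡ M
⊗-identityʳ (mat a b c d) = mat-cong (left a b) (right a b) (left c d) (right c d)
  where
  left : ∀ x y → x * 1ℤ + y * 0ℤ ≡ x
  left = solve-∀
  right : ∀ x y → x * 0ℤ + y * 1ℤ ≡ y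
  right = solve-∀

det-⊗ : ∀ M N → det (M ⊗ N) ≡ det M * det N
det-⊗ (mat a b c d) (mat e f g h) = cauchy-binet a b c d e f g h
  where
  cauchy-binet : ∀ a b c d e f g h →
    (a * e + b * g) * (c * f + d * h) - (a * f + b * h) * (c * e + d * g) ≡ (a * d - b * c) * (e * h - f * g)
  cauchy-binet = solve-∀

det-adj : ∀ M → det (adj M) ≡ det M
det-adj (mat a b c d) = identity a b c d
  where
  identity : ∀ a b c d → d * a - (- b) * (- c) ≡ a * d - b * c
  identity = solve-∀

adj-inverseˡ : ∀ M → InSL2 M → adj M ⊗ M ≡ I₂
adj-inverseˡ (mat a b c d) det≡1 =
  mat-cong (trans (diag₁ a b c d) det≡1) (off₁ b d) (off₂ c a) (trans (diag₂ a b c d) det≡1)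
  where
  diag₁ : ∀ a b c d → d * a + (- b) * c ≡ a * d - b * c
  diag₁ = solve-∀
  diag₂ : ∀ a b c d → (- c) * b + a * d ≡ a * d - b * c
  diag₂ = solve-∀
  off₁ : ∀ x y → y * x + (- x) * y ≡ 0ℤ
  off₁ = solve-∀
  off₂ : ∀ x y → (- x) * y + y * x ≡ 0ℤ
  off₂ = solve-∀

adj-inverseʳ : ∀ M → InSL2 M → M ⊗ adj M ≡ I₂
adj-inverseʳ (mat a b c d) det≡1 =
  mat-cong (trans (diag₁ a b c d) det≡1) (off₁ a b) (off₂ c d) (trans (diag₂ a b c d) det≡1)
  where
  diag₁ : ∀ a b c d → a * d + b * (- c) ≡ a * d - b * c
  diag₁ = solve-∀
  diag₂ : ∀ a b c d → c * (- b) + d * a ≡ a * d - b * c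
  diag₂ = solve-∀
  off₁ : ∀ x y → x * (- y) + y * x ≡ 0ℤ
  off₁ = solve-∀
  off₂ : ∀ x y → x * y + y * (- x) ≡ 0ℤ
  off₂ = solve-∀

InSL2-⊗ : ∀ {M N} → InSL2 M → InSL2 N → InSL2 (M ⊗ N)
InSL2-⊗ {M} {N} detM detN = trans (det-⊗ M N) (cong₂ _*_ detM detN)

InSL2-adj : ∀ {M} → InSL2 M → InSL2 (adj M)
InSL2-adj {M} detM = trans (det-adj M) detM

adj-cancelˡ : ∀ {γ A X} → InSL2 γ → γ ⊗ A ≡ X → A ≡ adj γ ⊗ X
adj-cancelˡ {γ} {A} {X} detγ γA≡X = begin
  A                ≡⟨ ⊗-identityˡ A ⟨
  I₂ ⊗ A           ≡⟨ cong (_⊗ A) (adj-inverseˡ γ detγ) ⟨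
  (adj γ ⊗ γ) ⊗ A  ≡⟨ ⊗-assoc (adj γ) γ A ⟩
  adj γ ⊗ (γ ⊗ A)  ≡⟨ cong (adj γ ⊗_) γA≡X ⟩
  adj γ ⊗ X        ∎
  where open ≡-Reasoning

InΓ₀-⊗ : ∀ {N γ δ} → InΓ₀ N γ → InΓ₀ N δ → InΓ₀ N (γ ⊗ δ)
InΓ₀-⊗ {N} {γ} {δ} (detγ , N∣cγ) (detδ , N∣cδ) =
  InSL2-⊗ {γ} {δ} detγ detδ ,
  Signed.∣⇒∣ᵤ {+ N} {c (γ ⊗ δ)}
    (Signed.∣m∣n⇒∣m+n (Signed.∣m⇒∣m*n (a δ) (Signed.∣ᵤ⇒∣ {+ N} {c γ} N∣cγ))
                      (Signed.∣n⇒∣m*n (d γ) (Signed.∣ᵤ⇒∣ {+ N} {c δ} N∣cδ)))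

InΓ₀-adj : ∀ {N γ} → InΓ₀ N γ → InΓ₀ N (adj γ)
InΓ₀-adj {N} {γ} (detγ , N∣cγ) =
  InSL2-adj {γ} detγ , Signed.∣⇒∣ᵤ {+ N} { - c γ} (Signed.∣m⇒∣-m (Signed.∣ᵤ⇒∣ {+ N} {c γ} N∣cγ))

InΓ₀-I₂ : ∀ N → InΓ₀ N I₂
InΓ₀-I₂ N = refl , divides 0 refl

∣-det : ∀ {e} M → e Signed.∣ c M → e Signed.∣ d M → e Signed.∣ det M
∣-det M e∣c e∣d = Signed.∣m∣n⇒∣m-n (Signed.∣n⇒∣m*n (a M) e∣d) (Signed.∣n⇒∣m*n (b M) e∣c)

upper : ℕ → ℕ → ℕ → Mat
upper c′ b′ d′ = mat (+ c′) (+ b′) 0ℤ (+ d′)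

det-upper : ∀ c′ b′ d′ → det (upper c′ b′ d′) ≡ + (c′ ℕ.* d′)
det-upper c′ b′ d′ = begin
  + c′ * + d′ - + b′ * 0ℤ  ≡⟨ cong (λ x → + c′ * + d′ - x) (ℤ.*-zeroʳ (+ b′)) ⟩
  + c′ * + d′ + 0ℤ         ≡⟨ ℤ.+-identityʳ (+ c′ * + d′) ⟩
  + c′ * + d′              ≡⟨ ℤ.pos-* c′ d′ ⟨
  + (c′ ℕ.* d′)            ∎
  where open ≡-Reasoning

⊗-upper : ∀ γ c′ b′ d′ →
  γ ⊗ upper c′ b′ d′ ≡
  mat (a γ * + c′) (a γ * + b′ + b γ * + d′) (c γ * + c′) (c γ * + b′ + d γ * + d′)
⊗-upper γ c′ b′ d′ = mat-cong (drop (a γ) (+ c′) (b γ)) refl (drop (c γ) (+ c′) (d γ)) refl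
  where
  drop : ∀ x y z → x * y + z * 0ℤ ≡ x * y
  drop = solve-∀

B-⊗ : ∀ m X → B m ⊗ X ≡ mat (+ m * a X) (+ m * b X) (c X) (d X)
B-⊗ m X = mat-cong (top (+ m) (a X) (c X)) (top (+ m) (b X) (d X)) (bottom (a X) (c X)) (bottom (b X) (d X))
  where
  top : ∀ x y z → x * y + 0ℤ * z ≡ x * y
  top = solve-∀
  bottom : ∀ y z → 0ℤ * y + 1ℤ * z ≡ z
  bottom = solve-∀

⊗-B : ∀ X m → X ⊗ B m ≡ mat (a X * + m) (b X) (c X * + m) (d X)
⊗-B X m = mat-cong (left (a X) (+ m) (b X)) (right (a X) (b X)) (left (c X) (+ m) (d X)) (right (c X) (d X))
  where
  left : ∀ x y z → x * y + z * 0ℤ ≡ x * y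
  left = solve-∀
  right : ∀ x z → x * 0ℤ + z * 1ℤ ≡ z
  right = solve-∀

det-B : ∀ m → det (B m) ≡ + m
det-B m = trans (det-upper m 0 1) (cong +_ (ℕ.*-identityʳ m))

-- The top row of the left factor is forced: it is (M x₁, M x₂) times (C B′; 0 D)⁻¹.
diagonal-factor : ∀ M C B′ D x₁ x₂ z w → M ≡ C * D →
  mat M 0ℤ 0ℤ 1ℤ ⊗ mat x₁ x₂ (z * C) (z * B′ + w * D) ≡
  mat (x₁ * D) (x₂ * C - x₁ * B′) z w ⊗ mat C B′ 0ℤ D
diagonal-factor _ C B′ D x₁ x₂ z w refl =
  mat-cong (entry-a C B′ D x₁ x₂ z) (entry-b C B′ D x₁ x₂ z w) (entry-c C x₁ z w) (entry-d B′ D x₂ z w)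
  where
  entry-a : ∀ C B′ D x₁ x₂ z → C * D * x₁ + 0ℤ * (z * C) ≡ x₁ * D * C + (x₂ * C - x₁ * B′) * 0ℤ
  entry-a = solve-∀
  entry-b : ∀ C B′ D x₁ x₂ z w →
            C * D * x₂ + 0ℤ * (z * B′ + w * D) ≡ x₁ * D * B′ + (x₂ * C - x₁ * B′) * D
  entry-b = solve-∀
  entry-c : ∀ C x₁ z w → 0ℤ * x₁ + 1ℤ * (z * C) ≡ z * C + w * 0ℤ
  entry-c = solve-∀
  entry-d : ∀ B′ D x₂ z w → 0ℤ * x₂ + 1ℤ * (z * B′ + w * D) ≡ z * B′ + w * D
  entry-d = solve-∀

B-factor : ∀ {m c′ b′ d′} x₁ x₂ z w → c′ ℕ.* d′ ≡ m →
  B m ⊗ mat x₁ x₂ (z * + c′) (z * + b′ + w * + d′) ≡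
  mat (x₁ * + d′) (x₂ * + c′ - x₁ * + b′) z w ⊗ upper c′ b′ d′
B-factor {m} {c′} {b′} {d′} x₁ x₂ z w c′d′≡m =
  diagonal-factor (+ m) (+ c′) (+ b′) (+ d′) x₁ x₂ z w (trans (cong +_ (sym c′d′≡m)) (ℤ.pos-* c′ d′))

InSL2-transfer : ∀ {m X γ A} .{{_ : NonZero m}} →
                 det A ≡ + m → B m ⊗ X ≡ γ ⊗ A → InSL2 X → InSL2 γ
InSL2-transfer {m} {X} {γ} {A} detA BX≡γA detX = ℤ.*-cancelʳ-≡ (det γ) 1ℤ (+ m) (begin
  det γ * + m        ≡⟨ cong (det γ *_) detA ⟨
  det γ * det A      ≡⟨ det-⊗ γ A ⟨
  det (γ ⊗ A)        ≡⟨ cong det BX≡γA ⟨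
  det (B m ⊗ X)      ≡⟨ det-⊗ (B m) X ⟩
  det (B m) * det X  ≡⟨ cong₂ _*_ (det-B m) detX ⟩
  + m * 1ℤ           ≡⟨ ℤ.*-comm (+ m) 1ℤ ⟩
  1ℤ * + m           ∎)
  where open ≡-Reasoning

InΓ₀-transfer : ∀ {n m X γ A} .{{_ : NonZero m}} → gcd n m ≡ 1 →
                InXstar m A → B m ⊗ X ≡ γ ⊗ A → InΓ₀ n X → InΓ₀ n γ
InΓ₀-transfer {n} {m} {X} {γ} gcd≡1 (c′ , b′ , d′ , _ , c′d′≡m , _ , _ , refl) BX≡γA (detX , n∣cX) =
  InSL2-transfer {m} {X} {γ} {upper c′ b′ d′} (trans (det-upper c′ b′ d′) (cong +_ c′d′≡m)) BX≡γA detX ,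
  ℤ.coprime-divisor (+ n) (+ c′) (c γ) n⊥c′ (subst (+ n ℤ.∣_) cX≡c′cγ n∣cX)
  where
  c′∣m : c′ ∣ m
  c′∣m = divides d′ (trans (sym c′d′≡m) (ℕ.*-comm c′ d′))
  n⊥c′ : Coprime n c′
  n⊥c′ (e∣n , e∣c′) = gcd≡1⇒coprime gcd≡1 (e∣n , ∣-trans e∣c′ c′∣m)
  cX≡c′cγ : c X ≡ + c′ * c γ
  cX≡c′cγ = begin
    c X                           ≡⟨ cong c (B-⊗ m X) ⟨
    c (B m ⊗ X)                   ≡⟨ cong c BX≡γA ⟩
    c (γ ⊗ upper c′ b′ d′)        ≡⟨ cong c (⊗-upper γ c′ b′ d′) ⟩
    c γ * + c′                    ≡⟨ ℤ.*-comm (c γ) (+ c′) ⟩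
    + c′ * c γ                    ∎
    where open ≡-Reasoning

B-conj-InSL2 : ∀ {m ε} → + m ℤ.∣ c ε → InSL2 ε → ∃ λ τ → InSL2 τ × B m ⊗ ε ≡ τ ⊗ B m
B-conj-InSL2 {m} {ε} m∣cε detε with Signed.∣ᵤ⇒∣ {+ m} {c ε} m∣cε
... | Signed.divides q cε≡qm = τ , detτ , (begin
  B m ⊗ ε                                      ≡⟨ B-⊗ m ε ⟩
  mat (+ m * a ε) (+ m * b ε) (c ε) (d ε)      ≡⟨ mat-cong (ℤ.*-comm (+ m) (a ε)) refl cε≡qm refl ⟩
  mat (a ε * + m) (+ m * b ε) (q * + m) (d ε)  ≡⟨ ⊗-B τ m ⟨
  τ ⊗ B m                                      ∎)
  where
  open ≡-Reasoning
  τ : Mat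
  τ = mat (a ε) (+ m * b ε) q (d ε)
  rearrange : ∀ x y z w q → x * z - w * y * q ≡ x * z - y * (q * w)
  rearrange = solve-∀
  detτ : InSL2 τ
  detτ = begin
    a ε * d ε - + m * b ε * q    ≡⟨ rearrange (a ε) (b ε) (d ε) (+ m) q ⟩
    a ε * d ε - b ε * (q * + m)  ≡⟨ cong (λ x → a ε * d ε - b ε * x) cε≡qm ⟨
    det ε                        ≡⟨ detε ⟩
    1ℤ                           ∎

B-conj-InΓ₀ : ∀ {n m ε τ} → InSL2 ε → InΓ₀ n τ → B m ⊗ ε ≡ τ ⊗ B m → InΓ₀ (n ℕ.* m) ε
B-conj-InΓ₀ {n} {m} {ε} {τ} detε (_ , n∣cτ) Bε≡τB =
  detε , subst (n ℕ.* m ∣_) (sym ∣cε∣≡∣cτ∣m) (*-monoˡ-∣ m n∣cτ)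
  where
  cε≡cτm : c ε ≡ c τ * + m
  cε≡cτm = trans (cong c (sym (B-⊗ m ε))) (trans (cong c Bε≡τB) (cong c (⊗-B τ m)))
  ∣cε∣≡∣cτ∣m : ∣ c ε ∣ ≡ ∣ c τ ∣ ℕ.* m
  ∣cε∣≡∣cτ∣m = trans (cong ∣_∣ cε≡cτm) (ℤ.abs-* (c τ) (+ m))

-- Hermite normal forms

upper-stabiliser : ∀ {c₁ b₁ d₁ c₂ b₂ d₂} σ → InSL2 σ → .{{NonZero c₁}} →
                   σ ⊗ upper c₁ b₁ d₁ ≡ upper c₂ b₂ d₂ → ∃ λ q → σ ≡ mat 1ℤ q 0ℤ 1ℤ
upper-stabiliser {suc k} {b₁} {d₁} (mat p q r s) detσ σA≡A′ = q , mat-cong p≡1 refl r≡0 s≡1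
  where
  entries = trans (sym (⊗-upper (mat p q r s) (suc k) b₁ d₁)) σA≡A′
  r≡0 : r ≡ 0ℤ
  r≡0 with ℤ.i*j≡0⇒i≡0∨j≡0 r (cong c entries)
  ... | inj₁ r≡0 = r≡0
  ... | inj₂ ()
  drop : ∀ p q s → p * s - q * 0ℤ ≡ p * s
  drop = solve-∀
  ps≡1 : p * s ≡ 1ℤ
  ps≡1 = trans (sym (drop p q s)) (subst (λ r → p * s - q * r ≡ 1ℤ) r≡0 detσ)
  p≡1 : p ≡ 1ℤ
  p≡1 = nonneg-unit≡1 ps≡1 (cong a entries)
  s≡1 : s ≡ 1ℤ
  s≡1 = trans (sym (ℤ.*-identityˡ s)) (subst (λ p → p * s ≡ 1ℤ) p≡1 ps≡1)

unipotent-upper-unique : ∀ {q c₁ b₁ d₁ c₂ b₂ d₂} →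
                         mat 1ℤ q 0ℤ 1ℤ ⊗ upper c₁ b₁ d₁ ≡ upper c₂ b₂ d₂ →
                         b₁ < d₁ → b₂ < d₂ → upper c₁ b₁ d₁ ≡ upper c₂ b₂ d₂
unipotent-upper-unique {q} {c₁} {b₁} {d₁} {b₂ = b₂} uA≡A′ b₁<d₁ b₂<d₂ =
  mat-cong c₁≡c₂ (cong +_ (residue-unique q b-entry b₁<d₁ (subst (b₂ <_) (sym d₁≡d₂) b₂<d₂)))
           refl (cong +_ d₁≡d₂)
  where
  entries = trans (sym (⊗-upper (mat 1ℤ q 0ℤ 1ℤ) c₁ b₁ d₁)) uA≡A′
  c₁≡c₂ : + c₁ ≡ + _
  c₁≡c₂ = trans (sym (ℤ.*-identityˡ (+ c₁))) (cong a entries)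
  b-entry : + b₁ + q * + d₁ ≡ + b₂
  b-entry = trans (cong (_+ q * + d₁) (sym (ℤ.*-identityˡ (+ b₁)))) (cong b entries)
  d₁≡d₂ : d₁ ≡ _
  d₁≡d₂ = ℤ.+-injective (trans (sym (trans (ℤ.+-identityˡ (1ℤ * + d₁)) (ℤ.*-identityˡ (+ d₁))))
                               (cong d entries))

InXstar-SL2-unique : ∀ {m m′ A A′ γ δ} → InXstar m A → InXstar m′ A′ → InSL2 γ → InSL2 δ →
                     γ ⊗ A ≡ δ ⊗ A′ → A ≡ A′
InXstar-SL2-unique {γ = γ} {δ} (c₁ , b₁ , d₁ , 1≤c₁ , _ , b₁<d₁ , _ , refl)
                               (c₂ , b₂ , d₂ , _ , _ , b₂<d₂ , _ , refl) detγ detδ γA≡δA′ =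
  unipotent-upper-unique {q} (subst (λ τ → τ ⊗ upper c₁ b₁ d₁ ≡ upper c₂ b₂ d₂) σ≡u σA≡A′)
                         b₁<d₁ b₂<d₂
  where
  σ : Mat
  σ = adj δ ⊗ γ
  σA≡A′ : σ ⊗ upper c₁ b₁ d₁ ≡ upper c₂ b₂ d₂
  σA≡A′ = trans (⊗-assoc (adj δ) γ (upper c₁ b₁ d₁)) (sym (adj-cancelˡ {δ} detδ (sym γA≡δA′)))
  stabiliser : ∃ λ q → σ ≡ mat 1ℤ q 0ℤ 1ℤ
  stabiliser = upper-stabiliser σ (InSL2-⊗ {adj δ} {γ} (InSL2-adj {δ} detδ) detγ) {{>-nonZero 1≤c₁}} σA≡A′
  q = proj₁ stabiliser
  σ≡u = proj₂ stabiliser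

upper-primitive : ∀ {m R γ c′ b′ d′} → InSL2 R → B m ⊗ R ≡ γ ⊗ upper c′ b′ d′ →
                  gcd (gcd c′ b′) d′ ≡ 1
upper-primitive {m} {R} {γ} {c′} {b′} {d′} detR BR≡γA =
  ∣1⇒≡1 (Signed.∣⇒∣ᵤ {+ e} {1ℤ} (subst (+ e Signed.∣_) detR (∣-det R e∣cR e∣dR)))
  where
  e = gcd (gcd c′ b′) d′
  ℕ∣⇒ℤ∣ : ∀ {x} → e ∣ x → + e Signed.∣ + x
  ℕ∣⇒ℤ∣ {x} = Signed.∣ᵤ⇒∣ {+ e} {+ x}
  e∣c′ = ℕ∣⇒ℤ∣ (∣-trans (gcd[m,n]∣m (gcd c′ b′) d′) (gcd[m,n]∣m c′ b′))
  e∣b′ = ℕ∣⇒ℤ∣ (∣-trans (gcd[m,n]∣m (gcd c′ b′) d′) (gcd[m,n]∣n c′ b′))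
  e∣d′ = ℕ∣⇒ℤ∣ (gcd[m,n]∣n (gcd c′ b′) d′)
  entries = trans (sym (B-⊗ m R)) (trans BR≡γA (⊗-upper γ c′ b′ d′))
  e∣cR : + e Signed.∣ c R
  e∣cR = subst (+ e Signed.∣_) (sym (cong c entries)) (Signed.∣n⇒∣m*n (c γ) e∣c′)
  e∣dR : + e Signed.∣ d R
  e∣dR = subst (+ e Signed.∣_) (sym (cong d entries))
           (Signed.∣m∣n⇒∣m+n (Signed.∣n⇒∣m*n (c γ) e∣b′) (Signed.∣n⇒∣m*n (d γ) e∣d′))

-- The bottom row (r, s) of R must equal (r₀, t) A with A = (g b′; 0 d′), g = gcd(|r|, m):
-- so r₀ = r / g, and b′ is determined modulo d′ = m / g by r₀ b′ ≡ s.
hermite-factorisation : ∀ {m} .{{_ : NonZero m}} R → InSL2 R →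
                        ∃ λ A → InXstar m A × ∃ λ γ → B m ⊗ R ≡ γ ⊗ A
hermite-factorisation {m} (mat p q r s) detR =
  upper g b′ d′ ,
  (g , b′ , d′ , ℕ.>-nonZero⁻¹ g , gd′≡m , b′<d′ , upper-primitive {m} {R} {γ} detR BR≡γA , refl) ,
  γ , BR≡γA
  where
  R = mat p q r s
  g = gcd ∣ r ∣ m
  instance
    _ : NonZero g
    _ = ≢-nonZero (gcd[m,n]≢0 ∣ r ∣ m (inj₂ (≢-nonZero⁻¹ m)))
  g∣r = Signed.∣ᵤ⇒∣ {+ g} {r} (gcd[m,n]∣m ∣ r ∣ m)
  r₀ = Signed.quotient g∣r
  r≡r₀g : r ≡ r₀ * + g
  r≡r₀g = Signed._∣_.equality g∣r
  g∣m = gcd[m,n]∣n ∣ r ∣ m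
  d′ = quotient g∣m
  m≡d′g : m ≡ d′ ℕ.* g
  m≡d′g = _∣_.equality g∣m
  gd′≡m : g ℕ.* d′ ≡ m
  gd′≡m = trans (ℕ.*-comm g d′) (sym m≡d′g)
  instance
    _ : NonZero d′
    _ = quotient≢0 g∣m
  r₀⊥d′ : ℤ.Coprime r₀ (+ d′)
  r₀⊥d′ = coprime-quotients {∣ r ∣} {m} {∣ r₀ ∣} {d′}
            (trans (cong ∣_∣ r≡r₀g) (ℤ.abs-* r₀ (+ g))) m≡d′g
  congruence = linear-congruence {r₀} {d′} r₀⊥d′ s
  b′ = proj₁ congruence
  t = proj₁ (proj₂ congruence)
  b′<d′ = proj₁ (proj₂ (proj₂ congruence))
  r₀b′+td′≡s = proj₂ (proj₂ (proj₂ congruence))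
  γ = mat (p * + d′) (q * + g - p * + b′) r₀ t
  BR≡γA : B m ⊗ R ≡ γ ⊗ upper g b′ d′
  BR≡γA = trans (cong (B m ⊗_) (mat-cong refl refl r≡r₀g (sym r₀b′+td′≡s)))
                (B-factor {m} {g} {b′} {d′} p q r₀ t gd′≡m)

Γ₀-hermite-factorisation : ∀ {n m R} .{{_ : NonZero m}} → gcd n m ≡ 1 → InΓ₀ n R →
                           ∃ λ A → InXstar m A × InCoset n A (B m ⊗ R)
Γ₀-hermite-factorisation {n} {m} {R} gcd≡1 R∈Γ₀ =
  let (A , A∈X , γ , BR≡γA) = hermite-factorisation R (proj₁ R∈Γ₀)
  in  A , A∈X , γ , InΓ₀-transfer {n} {m} {R} {γ} {A} gcd≡1 A∈X BR≡γA R∈Γ₀ , BR≡γA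

InXstar-realised : ∀ {n m A} .{{_ : NonZero n}} .{{_ : NonZero m}} → gcd n m ≡ 1 → InXstar m A →
                   ∃ λ g → InΓ₀ n g × InCoset n A (B m ⊗ g)
InXstar-realised {n} {m} gcd≡1 (c′ , b′ , d′ , 1≤c′ , c′d′≡m , _ , gcd[c′,b′,d′]≡1 , refl) =
  g , (detg , ∣m⇒∣m*n c′ ∣-refl) , γ , (detγ , ∣-refl) , Bg≡γA
  where
  instance
    _ : NonZero c′
    _ = >-nonZero 1≤c′
    _ : NonZero (n ℕ.* c′)
    _ = ℕ.m*n≢0 n c′
  d′∣m : d′ ∣ m
  d′∣m = divides c′ (sym c′d′≡m)
  common≡1 : ∀ {e} → e ∣ n ℕ.* c′ → e ∣ n ℕ.* b′ → e ∣ d′ → e ≡ 1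
  common≡1 {e} e∣nc′ e∣nb′ e∣d′ =
    ∣1⇒≡1 (subst (e ∣_) gcd[c′,b′,d′]≡1
      (gcd-greatest (gcd-greatest (coprime-divisor e⊥n e∣nc′) (coprime-divisor e⊥n e∣nb′)) e∣d′))
    where
    e⊥n : Coprime e n
    e⊥n (i∣e , i∣n) = gcd≡1⇒coprime gcd≡1 (i∣n , ∣-trans (∣-trans i∣e e∣d′) d′∣m)
  t = proj₁ (coprime-shift common≡1)
  r = n ℕ.* c′
  s = n ℕ.* b′ ℕ.+ t ℕ.* d′
  coefficients = bézout {+ r} {+ s} (proj₂ (coprime-shift common≡1))
  u = proj₁ coefficients
  v = proj₁ (proj₂ coefficients)
  g = mat v (- u) (+ r) (+ s)
  detg : InSL2 g
  detg = trans (swap u v (+ r) (+ s)) (proj₂ (proj₂ coefficients))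
    where
    swap : ∀ u v r s → v * s - (- u) * r ≡ u * r + v * s
    swap = solve-∀
  s≡ : + s ≡ + n * + b′ + + t * + d′
  s≡ = trans (ℤ.pos-+ (n ℕ.* b′) (t ℕ.* d′)) (cong₂ _+_ (ℤ.pos-* n b′) (ℤ.pos-* t d′))
  γ = mat (v * + d′) (- u * + c′ - v * + b′) (+ n) (+ t)
  Bg≡γA : B m ⊗ g ≡ γ ⊗ upper c′ b′ d′
  Bg≡γA = trans (cong (B m ⊗_) (mat-cong refl refl (ℤ.pos-* n c′) s≡))
                (B-factor {m} {c′} {b′} {d′} v (- u) (+ n) (+ t) c′d′≡m)
  detγ : InSL2 γ
  detγ = InSL2-transfer {m} {g} {γ} {upper c′ b′ d′}
           (trans (det-upper c′ b′ d′) (cong +_ c′d′≡m)) Bg≡γA detg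

-- Cosets of Γ₀(nm) in Γ₀(n)

InCoset-refl : ∀ N R → InCoset N R R
InCoset-refl N R = I₂ , InΓ₀-I₂ N , sym (⊗-identityˡ R)

common-factor⇒same-coset : ∀ {n m R₁ R₂ A} → InSL2 R₁ → InSL2 R₂ →
                           InCoset n A (B m ⊗ R₁) → InCoset n A (B m ⊗ R₂) → InCoset (n ℕ.* m) R₂ R₁
common-factor⇒same-coset {n} {m} {R₁} {R₂} {A} detR₁ detR₂
                         (γ₁ , γ₁∈Γ₀ , BR₁≡γ₁A) (γ₂ , γ₂∈Γ₀ , BR₂≡γ₂A) =
  ε , B-conj-InΓ₀ {n} {m} {ε} {τ} detε τ∈Γ₀ Bε≡τB , sym εR₂≡R₁
  where
  ε = R₁ ⊗ adj R₂
  τ = γ₁ ⊗ adj γ₂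
  detε : InSL2 ε
  detε = InSL2-⊗ {R₁} {adj R₂} detR₁ (InSL2-adj {R₂} detR₂)
  τ∈Γ₀ : InΓ₀ n τ
  τ∈Γ₀ = InΓ₀-⊗ {n} {γ₁} {adj γ₂} γ₁∈Γ₀ (InΓ₀-adj {n} {γ₂} γ₂∈Γ₀)
  εR₂≡R₁ : ε ⊗ R₂ ≡ R₁
  εR₂≡R₁ = trans (⊗-assoc R₁ (adj R₂) R₂)
                 (trans (cong (R₁ ⊗_) (adj-inverseˡ R₂ detR₂)) (⊗-identityʳ R₁))
  Bε≡τB : B m ⊗ ε ≡ τ ⊗ B m
  Bε≡τB = begin
    B m ⊗ (R₁ ⊗ adj R₂)                    ≡⟨ ⊗-assoc (B m) R₁ (adj R₂) ⟨
    (B m ⊗ R₁) ⊗ adj R₂                    ≡⟨ cong (_⊗ adj R₂) BR₁≡γ₁A ⟩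
    (γ₁ ⊗ A) ⊗ adj R₂                      ≡⟨ cong (λ X → (γ₁ ⊗ X) ⊗ adj R₂)
                                                   (adj-cancelˡ {γ₂} (proj₁ γ₂∈Γ₀) (sym BR₂≡γ₂A)) ⟩
    (γ₁ ⊗ (adj γ₂ ⊗ (B m ⊗ R₂))) ⊗ adj R₂  ≡⟨ cong (_⊗ adj R₂) (⊗-assoc γ₁ (adj γ₂) (B m ⊗ R₂)) ⟨
    (τ ⊗ (B m ⊗ R₂)) ⊗ adj R₂              ≡⟨ ⊗-assoc τ (B m ⊗ R₂) (adj R₂) ⟩
    τ ⊗ ((B m ⊗ R₂) ⊗ adj R₂)              ≡⟨ cong (τ ⊗_) (⊗-assoc (B m) R₂ (adj R₂)) ⟩
    τ ⊗ (B m ⊗ (R₂ ⊗ adj R₂))              ≡⟨ cong (λ X → τ ⊗ (B m ⊗ X)) (adj-inverseʳ R₂ detR₂) ⟩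
    τ ⊗ (B m ⊗ I₂)                         ≡⟨ cong (τ ⊗_) (⊗-identityʳ (B m)) ⟩
    τ ⊗ B m                                ∎
    where open ≡-Reasoning

same-coset⇒same-hermite : ∀ {n m R g A A′} → InXstar m A → InXstar m A′ → InCoset (n ℕ.* m) R g →
                          InCoset n A (B m ⊗ R) → InCoset n A′ (B m ⊗ g) → A ≡ A′
same-coset⇒same-hermite {n} {m} {R} {A = A} {A′} A∈X A′∈X
                        (ε , (detε , nm∣cε) , refl) (γ , γ∈Γ₀ , BR≡γA) (γ′ , γ′∈Γ₀ , Bg≡γ′A′) =
  let (τ , detτ , Bε≡τB) = B-conj-InSL2 {m} {ε} (m*n∣⇒n∣ n m nm∣cε) detε
  in  InXstar-SL2-unique {A = A} {A′} {τ ⊗ γ} {γ′} A∈X A′∈X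
        (InSL2-⊗ {τ} {γ} detτ (proj₁ γ∈Γ₀)) (proj₁ γ′∈Γ₀) (begin
        (τ ⊗ γ) ⊗ A     ≡⟨ ⊗-assoc τ γ A ⟩
        τ ⊗ (γ ⊗ A)     ≡⟨ cong (τ ⊗_) BR≡γA ⟨
        τ ⊗ (B m ⊗ R)   ≡⟨ ⊗-assoc τ (B m) R ⟨
        (τ ⊗ B m) ⊗ R   ≡⟨ cong (_⊗ R) Bε≡τB ⟨
        (B m ⊗ ε) ⊗ R   ≡⟨ ⊗-assoc (B m) ε R ⟩
        B m ⊗ (ε ⊗ R)   ≡⟨ Bg≡γ′A′ ⟩
        γ′ ⊗ A′         ∎)
  where open ≡-Reasoning

lemma5p3 : (n m : ℕ) → 1 ≤ n → 1 ≤ m → gcd n m ≡ 1 →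
    (k : ℕ) (R : Fin k → Mat) → IsCosetReps (n ℕ.* m) n k R →
    ∃ λ (A : Fin k → Mat) →
           ( (∀ j → InXstar m (A j))
           × (∀ j → ∃ λ (γ : Mat) → (InΓ₀ n γ × B m ⊗ R j ≡ γ ⊗ A j))
           × (∀ i j → A i ≡ A j → i ≡ j)
           × (∀ M → InXstar m M → ∃[ j ] A j ≡ M) )
lemma5p3 n m 1≤n 1≤m gcd≡1 k R (R∈Γ₀ , covering , disjoint) = A , A∈X , BR∈Γ₀A , injective , surjective
  where
  instance
    _ : NonZero n
    _ = >-nonZero 1≤n
    _ : NonZero m
    _ = >-nonZero 1≤m
  hermite : ∀ j → ∃ λ A → InXstar m A × InCoset n A (B m ⊗ R j)
  hermite j = Γ₀-hermite-factorisation gcd≡1 (R∈Γ₀ j)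
  A = λ j → proj₁ (hermite j)
  A∈X = λ j → proj₁ (proj₂ (hermite j))
  BR∈Γ₀A = λ j → proj₂ (proj₂ (hermite j))
  injective : ∀ i j → A i ≡ A j → i ≡ j
  injective i j Ai≡Aj = sym (disjoint (R i) j i
    (common-factor⇒same-coset (proj₁ (R∈Γ₀ i)) (proj₁ (R∈Γ₀ j))
      (subst (λ X → InCoset n X (B m ⊗ R i)) Ai≡Aj (BR∈Γ₀A i)) (BR∈Γ₀A j))
    (InCoset-refl (n ℕ.* m) (R i)))
  surjective : ∀ M → InXstar m M → ∃[ j ] A j ≡ M
  surjective M M∈X =
    let (g , g∈Γ₀ , Bg∈Γ₀M) = InXstar-realised gcd≡1 M∈X
        (j , g∈Γ₀Rⱼ) = covering g g∈Γ₀
    in  j , same-coset⇒same-hermite (A∈X j) M∈X g∈Γ₀Rⱼ (BR∈Γ₀A j) Bg∈Γ₀M
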